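{- Let $G$ be a finite simple graph with at least two vertices that has a perfect matching consisting only of pendant edges. Then $G$ is $\alpha^{++}$-stable if and only if $G$ contains no cycle on $4$ vertices (that is, no four vertices of $G$ span a subgraph containing a cycle of length $4$).
   Context: $\alpha(G)$ is the maximum size of a stable set of $G$. A pendant edge is an edge $vw$ such that $v$ has exactly one neighbour. For $e\in E(\overline{G})$ (a pair of distinct non-adjacent vertices), $G+e$ denotes $G$ with the edge $e$ added. $G$ is $\alpha^{++}$-stable if $\alpha(G+e_1+e_2)=\alpha(G)$ for any $e_1,e_2\in E(\overline{G})$ (not necessarily distinct). -}

module Defs where

open import Data.Nat using (ℕ; zero; suc; _⊔_; _≥_)
open import Data.Bool using (Bool; true; false; _∧_; _∨_; not; if_then_else_)
open import Data.Fin using (Fin; _≟_)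
open import Data.Fin.Subset using (Subset; _∈_; ∣_∣)
open import Data.Vec using (Vec; []; _∷_; lookup)
open import Data.List using (List; []; _∷_; map; _++_; foldr; allFin)
open import Data.Product using (Σ; _×_; _,_; ∃)
open import Relation.Binary.PropositionalEquality using (_≡_; _≢_)
open import Relation.Nullary using (¬_; does)

record Graph (n : ℕ) : Set where
  field
    adj    : Fin n → Fin n → Bool
    sym    : ∀ u v → adj u v ≡ adj v u
    irrefl : ∀ v → adj v v ≡ false
open Graph public

NonEdge : ∀ {n} → Graph n → Set
NonEdge {n} G = Σ (Fin n) λ u → Σ (Fin n) λ v → (u ≢ v) × (adj G u v ≡ false)

private
  eqᵇ : ∀ {n} → Fin n → Fin n → Bool
  eqᵇ x y = does (x ≟ y)

addEdge : ∀ {n} (G : Graph n) (u v : Fin n) → u ≢ v → Graph n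
addEdge {n} G u v u≢v = record
  { adj    = adj′
  ; sym    = sym′
  ; irrefl = irrefl′
  }
  where
  hit : Fin n → Fin n → Bool
  hit x y = (eqᵇ x u ∧ eqᵇ y v) ∨ (eqᵇ x v ∧ eqᵇ y u)
  adj′ : Fin n → Fin n → Bool
  adj′ x y = adj G x y ∨ hit x y
  open import Relation.Binary.PropositionalEquality using (refl; cong₂; cong)
  open import Data.Bool.Properties using (∨-comm; ∧-comm)
  open import Relation.Nullary using (yes; no)
  hit-sym : ∀ x y → hit x y ≡ hit y x
  hit-sym x y rewrite ∧-comm (eqᵇ x u) (eqᵇ y v) | ∧-comm (eqᵇ x v) (eqᵇ y u)
    = ∨-comm (eqᵇ y v ∧ eqᵇ x u) (eqᵇ y u ∧ eqᵇ x v)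
  sym′ : ∀ x y → adj′ x y ≡ adj′ y x
  sym′ x y = cong₂ _∨_ (sym G x y) (hit-sym x y)
  irrefl′ : ∀ x → adj′ x x ≡ false
  irrefl′ x rewrite irrefl G x with x ≟ u | x ≟ v
  ... | yes refl | yes refl = Data.Empty.⊥-elim (u≢v refl)
    where import Data.Empty
  ... | yes _ | no _ = refl
  ... | no _ | yes _ = refl
  ... | no _ | no _ = refl

-- G + e for e ∈ E(Ḡ) (e need only be a non-edge of the original graph,
-- so that G + e₁ + e₂ with e₁, e₂ ∈ E(Ḡ) makes sense as in the paper).
addNonEdge : ∀ {n} (H : Graph n) → Graph n → NonEdge H → Graph n
addNonEdge H G (u , v , u≢v , _) = addEdge G u v u≢v

subsets : ∀ n → List (Subset n)
subsets zero    = [] ∷ []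
subsets (suc n) = map (true ∷_) (subsets n) ++ map (false ∷_) (subsets n)

allᵇ : ∀ {A : Set} → (A → Bool) → List A → Bool
allᵇ p = foldr (λ x b → p x ∧ b) true

isStable : ∀ {n} → Graph n → Subset n → Bool
isStable {n} G S =
  allᵇ (λ i → allᵇ (λ j → not (lookup S i ∧ lookup S j ∧ adj G i j)) (allFin n)) (allFin n)

α : ∀ {n} → Graph n → ℕ
α {n} G = foldr (λ S m → (if isStable G S then ∣ S ∣ else 0) ⊔ m) 0 (subsets n)

AlphaPlusPlusStable : ∀ {n} → Graph n → Set
AlphaPlusPlusStable G =
  ∀ (e₁ e₂ : NonEdge G) → α (addNonEdge G (addNonEdge G G e₁) e₂) ≡ α G
  -- note: e₂ is a non-edge of G; if e₂ = e₁ then adding it again changes nothing.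

PendantAt : ∀ {n} → Graph n → Fin n → Fin n → Set
PendantAt {n} G v w = (adj G v w ≡ true) × (∀ x → adj G v x ≡ true → x ≡ w)

PendantEdge : ∀ {n} → Graph n → Fin n → Fin n → Set
PendantEdge G v w = PendantAt G v w ⊎' PendantAt G w v
  where
  open import Data.Sum using () renaming (_⊎_ to _⊎'_)

-- A perfect matching, represented by the partner map (a fixed-point-free
-- involution along edges), all of whose edges are pendant.
HasPendantPerfectMatching : ∀ {n} → Graph n → Set
HasPendantPerfectMatching {n} G =
  Σ (Fin n → Fin n) λ m →
    (∀ v → adj G v (m v) ≡ true) ×
    (∀ v → m (m v) ≡ v) ×
    (∀ v → PendantEdge G v (m v))

HasC4 : ∀ {n} → Graph n → Set
HasC4 {n} G = Σ (Fin n) λ a → Σ (Fin n) λ b → Σ (Fin n) λ c → Σ (Fin n) λ d →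
  (a ≢ b) × (a ≢ c) × (a ≢ d) × (b ≢ c) × (b ≢ d) × (c ≢ d) ×
  (adj G a b ≡ true) × (adj G b c ≡ true) × (adj G c d ≡ true) × (adj G d a ≡ true)

{-# OPTIONS --safe #-}
module Submission where

-- Let m be the pendant perfect matching.  Every graph containing the matching edges has α at
-- most the number of pairs {v, m v}, with equality only if some stable set meets every pair,
-- and G attains this bound by taking a leaf from each pair.  The vertices of a 4-cycle a b c d
-- are not leaves, so their mates are, and after adding the edges (m a)(m c) and (m b)(m d)
-- every stable set misses a pair.  Conversely, in a C4-free G, for any two added edges one can
-- exchange the leaf for its mate in at most two pairs so that the resulting transversal is
-- stable and avoids both new edges: the mates brought in must be non-adjacent, and if all four
-- candidate choices were adjacent they would span a 4-cycle.

open import Defs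
open import Data.Nat using (ℕ; _≥_)
open import Relation.Nullary using (¬_)
open import Data.Product using (_×_)

open import Data.Bool using (Bool; true; false; _∧_; _∨_; not; if_then_else_)
open import Data.Bool.Properties using (not-injective; ∨-zeroʳ) renaming (_≟_ to _≟ᵇ_)
open import Data.Empty using (⊥; ⊥-elim)
open import Data.Fin using (Fin; zero; suc; _≟_; _<?_)
open import Data.Fin.Properties using (<-cmp; all?)
open import Data.Fin.Permutation using (Permutation; permutation)
open import Data.Fin.Subset using (Subset; ∣_∣)
open import Data.List using ([]; _∷_; foldr; map; allFin)
open import Data.List.Membership.Propositional using (_∈_)
open import Data.List.Membership.Propositional.Properties using (∈-allFin; ∈-++⁺ˡ; ∈-++⁺ʳ; ∈-map⁺)
open import Data.List.Relation.Unary.Any using (here; there)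
open import Data.Nat using (zero; suc; _+_; _*_; _≤_; _<_; _⊔_; z≤n; s≤s)
open import Data.Nat.Properties
  using (≤-trans; ≤-antisym; ≤-pred; <-irrefl; n≮0; +-identityʳ; +-mono-≤; +-mono-<-≤; +-mono-≤-<;
         *-cancelˡ-≤; *-cancelˡ-<; m≤m⊔n; m≤n⊔m; ⊔-lub; +-0-commutativeMonoid; module ≤-Reasoning)
open import Algebra.Properties.CommutativeMonoid.Sum +-0-commutativeMonoid
  using (sum; sum-cong-≗; sum-permute; sum-replicate-zero; ∑-distrib-+)
open import Data.Product using (∃; _,_; proj₁; proj₂; map₂; swap)
open import Data.Sum as Sum using (_⊎_; inj₁; inj₂)
open import Data.Vec using ([]; _∷_; lookup; tabulate)
open import Data.Vec.Properties using (lookup∘tabulate)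
open import Function using (_∘_)
open import Relation.Binary.Definitions using (tri<; tri≈; tri>)
open import Relation.Binary.PropositionalEquality as ≡
  using (_≡_; _≢_; _≗_; refl; trans; cong; cong₂; subst; subst₂; module ≡-Reasoning)
open import Relation.Nullary using (Dec; yes; no; does)
open import Relation.Nullary.Decidable using (dec-true; dec-false; _→-dec_)

∨-true : ∀ a {b} → a ∨ b ≡ true → a ≡ true ⊎ b ≡ true
∨-true true  _ = inj₁ refl
∨-true false e = inj₂ e

∧-true : ∀ a {b} → a ∧ b ≡ true → a ≡ true × b ≡ true
∧-true true e = refl , e

≡true⇒≢false : ∀ {b} → b ≡ true → b ≢ false
≡true⇒≢false refl ()

dec-true⁻¹ : ∀ {P : Set} (p? : Dec P) → does p? ≡ true → P
dec-true⁻¹ (yes p) _ = p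

toℕ : Bool → ℕ
toℕ b = if b then 1 else 0

<?-flip : ∀ {n} {x y : Fin n} → x ≢ y → does (y <? x) ≡ not (does (x <? y))
<?-flip {x = x} {y} x≢y with <-cmp x y
... | tri< x<y _ y≮x = trans (dec-false (y <? x) y≮x) (cong not (≡.sym (dec-true (x <? y) x<y)))
... | tri≈ _ x≡y _   = ⊥-elim (x≢y x≡y)
... | tri> x≮y _ y<x = trans (dec-true (y <? x) y<x) (cong not (≡.sym (dec-false (x <? y) x≮y)))

sum-mono-≤ : ∀ {n} {f g : Fin n → ℕ} → (∀ i → f i ≤ g i) → sum f ≤ sum g
sum-mono-≤ {zero}  _   = z≤n
sum-mono-≤ {suc n} f≤g = +-mono-≤ (f≤g zero) (sum-mono-≤ (f≤g ∘ suc))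

sum-mono-< : ∀ {n} {f g : Fin n → ℕ} → (∀ i → f i ≤ g i) → ∀ j → f j < g j → sum f < sum g
sum-mono-< f≤g zero    fj<gj = +-mono-<-≤ fj<gj (sum-mono-≤ (f≤g ∘ suc))
sum-mono-< f≤g (suc j) fj<gj = +-mono-≤-< (f≤g zero) (sum-mono-< (f≤g ∘ suc) j fj<gj)

module _ {A : Set} (f : A → ℕ) where

  ≤-foldr-⊔ : ∀ {xs x} → x ∈ xs → f x ≤ foldr (λ y k → f y ⊔ k) 0 xs
  ≤-foldr-⊔ {y ∷ _} (here refl)  = m≤m⊔n (f y) _
  ≤-foldr-⊔ {y ∷ _} (there x∈xs) = ≤-trans (≤-foldr-⊔ x∈xs) (m≤n⊔m (f y) _)

  foldr-⊔-lub : ∀ xs {k} → (∀ x → x ∈ xs → f x ≤ k) → foldr (λ y k → f y ⊔ k) 0 xs ≤ k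
  foldr-⊔-lub []       _ = z≤n
  foldr-⊔-lub (y ∷ xs) h = ⊔-lub (h y (here refl)) (foldr-⊔-lub xs (λ x → h x ∘ there))

Stable : ∀ {n} → Graph n → (Fin n → Bool) → Set
Stable G s = ∀ u v → s u ≡ true → s v ≡ true → adj G u v ≡ false

size : ∀ {n} → (Fin n → Bool) → ℕ
size s = sum (toℕ ∘ s)

adj-sym : ∀ {n} (G : Graph n) {u v} → adj G u v ≡ true → adj G v u ≡ true
adj-sym G {u} {v} e = trans (sym G v u) e

adj⇒≢ : ∀ {n} (G : Graph n) {u v} → adj G u v ≡ true → u ≢ v
adj⇒≢ G {u} e refl = ≡true⇒≢false e (irrefl G u)

Stable-nbr : ∀ {n} (G : Graph n) {s u v} → Stable G s → s u ≡ true → adj G u v ≡ true → s v ≡ false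
Stable-nbr G {s} {u} {v} st su uv with s v in sv
... | false = refl
... | true  = ⊥-elim (≡true⇒≢false uv (st u v su sv))

Stable-resp-≗ : ∀ {n} {G : Graph n} {s s′} → s ≗ s′ → Stable G s → Stable G s′
Stable-resp-≗ s≗s′ st u v su sv = st u v (trans (s≗s′ u) su) (trans (s≗s′ v) sv)

size-∅ : ∀ {n} → size {n} (λ _ → false) ≡ 0
size-∅ {n} = sum-replicate-zero n

∣∣≡size : ∀ {n} (S : Subset n) → ∣ S ∣ ≡ size (lookup S)
∣∣≡size []          = refl
∣∣≡size (true ∷ S)  = cong suc (∣∣≡size S)
∣∣≡size (false ∷ S) = ∣∣≡size S

allᵇ-sound : ∀ {A : Set} (p : A → Bool) {xs x} → allᵇ p xs ≡ true → x ∈ xs → p x ≡ true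
allᵇ-sound p {y ∷ _} h (here refl)  = proj₁ (∧-true (p y) h)
allᵇ-sound p {y ∷ _} h (there x∈xs) = allᵇ-sound p (proj₂ (∧-true (p y) h)) x∈xs

allᵇ-complete : ∀ {A : Set} (p : A → Bool) xs → (∀ x → p x ≡ true) → allᵇ p xs ≡ true
allᵇ-complete p []       _ = refl
allᵇ-complete p (x ∷ xs) h rewrite h x = allᵇ-complete p xs h

isStable-sound : ∀ {n} (G : Graph n) (S : Subset n) → isStable G S ≡ true → Stable G (lookup S)
isStable-sound G S h u v =
  nand (allᵇ-sound _ (allᵇ-sound _ h (∈-allFin u)) (∈-allFin v))
  where
  nand : ∀ {a b c} → not (a ∧ b ∧ c) ≡ true → a ≡ true → b ≡ true → c ≡ false
  nand {c = false} _ refl refl = refl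

isStable-complete : ∀ {n} (G : Graph n) (S : Subset n) → Stable G (lookup S) → isStable G S ≡ true
isStable-complete {n} G S st =
  allᵇ-complete _ (allFin n) λ u → allᵇ-complete _ (allFin n) λ v → nand (lookup S u) (lookup S v) (st u v)
  where
  nand : ∀ a b {c} → (a ≡ true → b ≡ true → c ≡ false) → not (a ∧ b ∧ c) ≡ true
  nand true  true  h rewrite h refl refl = refl
  nand true  false _ = refl
  nand false _     _ = refl

subsets-complete : ∀ {n} (S : Subset n) → S ∈ subsets n
subsets-complete []          = here refl
subsets-complete (true ∷ S)  = ∈-++⁺ˡ (∈-map⁺ (true ∷_) (subsets-complete S))
subsets-complete (false ∷ S) = ∈-++⁺ʳ (map (true ∷_) (subsets _)) (∈-map⁺ (false ∷_) (subsets-complete S))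

size≤α : ∀ {n} (G : Graph n) {s} → Stable G s → size s ≤ α G
size≤α {n} G {s} st = subst (_≤ α G) ∣S∣≡size-s ∣S∣≤α
  where
  S : Subset n
  S = tabulate s
  ∣S∣≡size-s : ∣ S ∣ ≡ size s
  ∣S∣≡size-s = trans (∣∣≡size S) (sum-cong-≗ (cong toℕ ∘ lookup∘tabulate s))
  S-stable : isStable G S ≡ true
  S-stable = isStable-complete G S (Stable-resp-≗ {G = G} (≡.sym ∘ lookup∘tabulate s) st)
  ∣S∣≤α : ∣ S ∣ ≤ α G
  ∣S∣≤α = subst (λ b → (if b then ∣ S ∣ else 0) ≤ α G) S-stable (≤-foldr-⊔ _ (subsets-complete S))

α≤ : ∀ {n} (G : Graph n) {k} → (∀ s → Stable G s → size s ≤ k) → α G ≤ k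
α≤ {n} G {k} h = foldr-⊔-lub _ (subsets n) (λ S _ → bound S)
  where
  bound : ∀ S → (if isStable G S then ∣ S ∣ else 0) ≤ k
  bound S with isStable G S in e
  ... | true  = subst (_≤ k) (≡.sym (∣∣≡size S)) (h (lookup S) (isStable-sound G S e))
  ... | false = z≤n

α< : ∀ {n} (G : Graph n) {k} → (∀ s → Stable G s → size s < k) → α G < k
α< {n} G {zero}  h = ⊥-elim (n≮0 (subst (_< 0) (size-∅ {n}) (h (λ _ → false) (λ _ _ ()))))
α< G {suc k} h = s≤s (α≤ G (λ s st → ≤-pred (h s st)))

infix 4 _⊆ᴱ_
_⊆ᴱ_ : ∀ {n} → Graph n → Graph n → Set
G ⊆ᴱ H = ∀ {u v} → adj G u v ≡ true → adj H u v ≡ true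

⊆ᴱ-trans : ∀ {n} {G H K : Graph n} → G ⊆ᴱ H → H ⊆ᴱ K → G ⊆ᴱ K
⊆ᴱ-trans G⊆H H⊆K = H⊆K ∘ G⊆H

Stable-antitone : ∀ {n} {G H : Graph n} {s} → G ⊆ᴱ H → Stable H s → Stable G s
Stable-antitone {G = G} G⊆H st u v su sv with adj G u v in uv
... | false = refl
... | true  = ⊥-elim (≡true⇒≢false (G⊆H uv) (st u v su sv))

α-antitone : ∀ {n} {G H : Graph n} → G ⊆ᴱ H → α H ≤ α G
α-antitone {G = G} {H} G⊆H = α≤ H (λ s st → size≤α G (Stable-antitone {G = G} {H} G⊆H st))

⊆ᴱ-addEdge : ∀ {n} (G : Graph n) {u v} (u≢v : u ≢ v) → G ⊆ᴱ addEdge G u v u≢v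
⊆ᴱ-addEdge _ _ e = cong (_∨ _) e

addEdge-adj : ∀ {n} (G : Graph n) {u v} (u≢v : u ≢ v) → adj (addEdge G u v u≢v) u v ≡ true
addEdge-adj G {u} {v} _ rewrite dec-true (u ≟ u) refl | dec-true (v ≟ v) refl = ∨-zeroʳ (adj G u v)

addEdge-adj⁻ : ∀ {n} {G : Graph n} {u v} {u≢v : u ≢ v} {a b} → adj (addEdge G u v u≢v) a b ≡ true →
               adj G a b ≡ true ⊎ (a ≡ u × b ≡ v) ⊎ (a ≡ v × b ≡ u)
addEdge-adj⁻ {G = G} {u} {v} {_} {a} {b} e with ∨-true (adj G a b) e
... | inj₁ ab  = inj₁ ab
... | inj₂ hit = inj₂ (Sum.map ≟-pair ≟-pair (∨-true (does (a ≟ u) ∧ does (b ≟ v)) hit))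
  where
  ≟-pair : ∀ {x y x′ y′ : Fin _} → does (x ≟ x′) ∧ does (y ≟ y′) ≡ true →
           x ≡ x′ × y ≡ y′
  ≟-pair {x} {y} {x′} {y′} h with ∧-true (does (x ≟ x′)) h
  ... | x≡x′ , y≡y′ = dec-true⁻¹ (x ≟ x′) x≡x′ , dec-true⁻¹ (y ≟ y′) y≡y′

Avoids : ∀ {n} → (Fin n → Bool) → Fin n → Fin n → Set
Avoids s x y = ∃ λ u → (u ≡ x ⊎ u ≡ y) × s u ≡ false

Avoids-or-both : ∀ {n} (s : Fin n → Bool) x y → Avoids s x y ⊎ (s x ≡ true × s y ≡ true)
Avoids-or-both s x y with s x in sx | s y in sy
... | false | _     = inj₁ (x , inj₁ refl , sx)
... | true  | false = inj₁ (y , inj₂ refl , sy)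
... | true  | true  = inj₂ (refl , refl)

Avoids⇒¬both : ∀ {n} {s : Fin n → Bool} {x y} → Avoids s x y → s x ≡ true → s y ≡ true → ⊥
Avoids⇒¬both (_ , inj₁ refl , su) sx _ = ≡true⇒≢false sx su
Avoids⇒¬both (_ , inj₂ refl , su) _ sy = ≡true⇒≢false sy su

Stable-addEdge : ∀ {n} (G : Graph n) {s u v} (u≢v : u ≢ v) →
                 Stable G s → Avoids s u v → Stable (addEdge G u v u≢v) s
Stable-addEdge G {u = u} {v} u≢v st avoid a b sa sb with adj (addEdge G u v u≢v) a b in e
... | false = refl
... | true with addEdge-adj⁻ {G = G} {u≢v = u≢v} e
...   | inj₁ ab                   = ⊥-elim (≡true⇒≢false ab (st a b sa sb))
...   | inj₂ (inj₁ (refl , refl)) = ⊥-elim (Avoids⇒¬both avoid sa sb)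
...   | inj₂ (inj₂ (refl , refl)) = ⊥-elim (Avoids⇒¬both avoid sb sa)

module Pairing {n} (m : Fin n → Fin n) (m-involutive : ∀ v → m (m v) ≡ v) where

  Transversal : (Fin n → Bool) → Set
  Transversal t = ∀ v → t (m v) ≡ not (t v)

  MissesPair : (Fin n → Bool) → Set
  MissesPair s = ∃ λ v → s v ≡ false × s (m v) ≡ false

  Matched : Graph n → Set
  Matched K = ∀ v → adj K v (m v) ≡ true

  transversal-mate : ∀ {t v} → Transversal t → t v ≡ true → t (m v) ≡ false
  transversal-mate {v = v} tr tv = trans (tr v) (cong not tv)

  pairCount : (Fin n → Bool) → Fin n → ℕ
  pairCount s v = toℕ (s v) + toℕ (s (m v))

  2*size≡sum-pairCount : ∀ s → 2 * size s ≡ sum (pairCount s)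
  2*size≡sum-pairCount s = begin
    2 * size s             ≡⟨ cong (size s +_) (+-identityʳ (size s)) ⟩
    size s + size s        ≡⟨ cong (size s +_) (sum-permute (toℕ ∘ s) m-permutation) ⟩
    size s + size (s ∘ m)  ≡⟨ ∑-distrib-+ (toℕ ∘ s) (toℕ ∘ s ∘ m) ⟨
    sum (pairCount s)      ∎
    where
    open ≡-Reasoning
    m-permutation : Permutation n n
    m-permutation = permutation m m m-involutive m-involutive

  pairCount-transversal : ∀ {t} → Transversal t → ∀ v → pairCount t v ≡ 1
  pairCount-transversal {t} tr v rewrite tr v with t v
  ... | true  = refl
  ... | false = refl

  pairCount-stable : ∀ {K s} → Matched K → Stable K s → ∀ v → pairCount s v ≤ 1
  pairCount-stable {s = s} matched st v with s v in sv | s (m v) in smv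
  ... | true  | true  = ⊥-elim (≡true⇒≢false (matched v) (st v (m v) sv smv))
  ... | true  | false = s≤s z≤n
  ... | false | true  = s≤s z≤n
  ... | false | false = z≤n

  pairCount-misses : ∀ {s v} → s v ≡ false → s (m v) ≡ false → pairCount s v ≡ 0
  pairCount-misses sv smv rewrite sv | smv = refl

  pairCount-stable≤transversal : ∀ {K s t} → Matched K → Stable K s → Transversal t →
                                 ∀ v → pairCount s v ≤ pairCount t v
  pairCount-stable≤transversal {K} {s} {t} matched st tr v =
    subst (pairCount s v ≤_) (≡.sym (pairCount-transversal {t} tr v)) (pairCount-stable {K} {s} matched st v)

  size-≤-transversal : ∀ {K s t} → Matched K → Stable K s → Transversal t → size s ≤ size t
  size-≤-transversal {K} {s} {t} matched st tr = *-cancelˡ-≤ 2 (begin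
    2 * size s          ≡⟨ 2*size≡sum-pairCount s ⟩
    sum (pairCount s)   ≤⟨ sum-mono-≤ (pairCount-stable≤transversal {K} {s} {t} matched st tr) ⟩
    sum (pairCount t)   ≡⟨ 2*size≡sum-pairCount t ⟨
    2 * size t          ∎)
    where open ≤-Reasoning

  size-<-transversal : ∀ {K s t} → Matched K → Stable K s → MissesPair s → Transversal t → size s < size t
  size-<-transversal {K} {s} {t} matched st (v , sv , smv) tr = *-cancelˡ-< 2 _ _ (begin-strict
    2 * size s          ≡⟨ 2*size≡sum-pairCount s ⟩
    sum (pairCount s)   <⟨ sum-mono-< (pairCount-stable≤transversal {K} {s} {t} matched st tr) v empty<full ⟩
    sum (pairCount t)   ≡⟨ 2*size≡sum-pairCount t ⟨
    2 * size t          ∎)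
    where
    open ≤-Reasoning
    empty<full : pairCount s v < pairCount t v
    empty<full = subst₂ _<_ (≡.sym (pairCount-misses {s} sv smv)) (≡.sym (pairCount-transversal {t} tr v))
                        (s≤s z≤n)

  α≤size-transversal : ∀ {K t} → Matched K → Transversal t → α K ≤ size t
  α≤size-transversal {K} matched tr = α≤ K (λ s st → size-≤-transversal {K} matched st tr)

  α<size-transversal : ∀ {K t} → Matched K → (∀ s → Stable K s → MissesPair s) → Transversal t →
                       α K < size t
  α<size-transversal {K} matched misses tr = α< K (λ s st → size-<-transversal {K} matched st (misses s st) tr)

  mates-adj⇒MissesPair : ∀ {K s u v} → Stable K s → adj K (m u) (m v) ≡ true →
                         s u ≡ false → s v ≡ false → MissesPair s
  mates-adj⇒MissesPair {s = s} {u} {v} st e su sv with s (m u) in smu | s (m v) in smv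
  ... | false | _     = u , su , smu
  ... | true  | false = v , sv , smv
  ... | true  | true  = ⊥-elim (≡true⇒≢false e (st (m u) (m v) smu smv))

  square⇒MissesPair : ∀ {K s a b c d} → Stable K s →
                      adj K a b ≡ true → adj K b c ≡ true → adj K c d ≡ true → adj K d a ≡ true →
                      adj K (m a) (m c) ≡ true → adj K (m b) (m d) ≡ true → MissesPair s
  square⇒MissesPair {K} {s} {a} {c = c} st ab bc cd da ac bd with s a in sa | s c in sc
  ... | true  | _     = mates-adj⇒MissesPair {K} st bd (Stable-nbr K st sa ab) (Stable-nbr K st sa (adj-sym K da))
  ... | false | true  = mates-adj⇒MissesPair {K} st bd (Stable-nbr K st sc (adj-sym K bc)) (Stable-nbr K st sc cd)
  ... | false | false = mates-adj⇒MissesPair {K} st ac sa sc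

  pick : (Fin n → Bool) → Fin n → Bool
  pick p v = p v ∧ (not (p (m v)) ∨ does (v <? m v))

  pick-⊆ : ∀ {p v} → pick p v ≡ true → p v ≡ true
  pick-⊆ {p} {v} = proj₁ ∘ ∧-true (p v)

  pick-transversal : (∀ v → v ≢ m v) → ∀ {p} → (∀ v → p v ≡ true ⊎ p (m v) ≡ true) →
                     Transversal (pick p)
  pick-transversal fpf {p} cover v = begin
    p (m v) ∧ (not (p (m (m v))) ∨ does (m v <? m (m v)))
      ≡⟨ cong (λ u → p (m v) ∧ (not (p u) ∨ does (m v <? u))) (m-involutive v) ⟩
    p (m v) ∧ (not (p v) ∨ does (m v <? v))
      ≡⟨ cong (λ b → p (m v) ∧ (not (p v) ∨ b)) (<?-flip (fpf v)) ⟩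
    p (m v) ∧ (not (p v) ∨ not (does (v <? m v)))
      ≡⟨ tie-break (does (v <? m v)) (cover v) ⟩
    not (pick p v)
      ∎
    where
    open ≡-Reasoning
    tie-break : ∀ {a b} c → a ≡ true ⊎ b ≡ true → b ∧ (not a ∨ not c) ≡ not (a ∧ (not b ∨ c))
    tie-break {true}  {true}  c _ = refl
    tie-break {true}  {false} c _ = refl
    tie-break {false} {true}  c _ = refl
    tie-break {false} {false} c (inj₁ ())
    tie-break {false} {false} c (inj₂ ())

  exchange : (Fin n → Bool) → (Fin n → Bool) → Fin n → Bool
  exchange t H v = H v ∨ (t v ∧ not (H (m v)))

  module Exchange (t H : Fin n → Bool) where

    exchange-transversal : Transversal t → (∀ v → H v ≡ true → t v ≡ false) → Transversal (exchange t H)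
    exchange-transversal tr H⊥t v = begin
      H (m v) ∨ (t (m v) ∧ not (H (m (m v))))
        ≡⟨ cong₂ (λ b h → H (m v) ∨ (b ∧ not (H h))) (tr v) (m-involutive v) ⟩
      H (m v) ∨ (not (t v) ∧ not (H v))
        ≡⟨ exchanged (H⊥t v) (λ h → not-injective (trans (≡.sym (tr v)) (H⊥t (m v) h))) ⟩
      not (exchange t H v)
        ∎
      where
      open ≡-Reasoning
      exchanged : ∀ {b h h′} → (h ≡ true → b ≡ false) → (h′ ≡ true → b ≡ true) →
                  h′ ∨ (not b ∧ not h) ≡ not (h ∨ (b ∧ not h′))
      exchanged {true}  {true}  {_}     ¬b _ = ⊥-elim (≡true⇒≢false refl (¬b refl))
      exchanged {true}  {false} {true}  _  _ = refl
      exchanged {true}  {false} {false} _  _ = refl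
      exchanged {false} {_}     {true}  _ b  = ⊥-elim (≡true⇒≢false (b refl) refl)
      exchanged {false} {true}  {false} _  _ = refl
      exchanged {false} {false} {false} _  _ = refl

    exchange-⊇ : ∀ {v} → H v ≡ true → exchange t H v ≡ true
    exchange-⊇ hv rewrite hv = refl

    exchange-⊆ : ∀ {v} → exchange t H v ≡ true → H v ≡ true ⊎ t v ≡ true
    exchange-⊆ {v} e = Sum.map₂ (proj₁ ∘ ∧-true (t v)) (∨-true (H v) e)

    exchange-outside : ∀ {v} → t v ≡ false → H v ≡ false → exchange t H v ≡ false
    exchange-outside tv hv rewrite tv | hv = refl

    exchange-mate : Transversal (exchange t H) → ∀ {v} → H (m v) ≡ true → exchange t H v ≡ false
    exchange-mate tr {v} hmv =
      subst (λ u → exchange t H u ≡ false) (m-involutive v) (transversal-mate tr (exchange-⊇ hmv))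

⁅_,_⁆ : ∀ {n} → Fin n → Fin n → Fin n → Bool
⁅ p , q ⁆ v = does (v ≟ p) ∨ does (v ≟ q)

⁅,⁆-left : ∀ {n} (p q : Fin n) → ⁅ p , q ⁆ p ≡ true
⁅,⁆-left p q rewrite dec-true (p ≟ p) refl = refl

⁅,⁆-right : ∀ {n} (p q : Fin n) → ⁅ p , q ⁆ q ≡ true
⁅,⁆-right p q rewrite dec-true (q ≟ q) refl = ∨-zeroʳ (does (q ≟ p))

⁅,⁆⁻ : ∀ {n} {p q v : Fin n} → ⁅ p , q ⁆ v ≡ true → v ≡ p ⊎ v ≡ q
⁅,⁆⁻ {p = p} {q} {v} e = Sum.map (dec-true⁻¹ (v ≟ p)) (dec-true⁻¹ (v ≟ q)) (∨-true (does (v ≟ p)) e)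

⁅,⁆-outside : ∀ {n} {p q v : Fin n} → v ≢ p → v ≢ q → ⁅ p , q ⁆ v ≡ false
⁅,⁆-outside {p = p} {q} {v} v≢p v≢q rewrite dec-false (v ≟ p) v≢p | dec-false (v ≟ q) v≢q = refl

Stable-⁅,⁆ : ∀ {n} {G : Graph n} {p q} → adj G p q ≡ false → Stable G ⁅ p , q ⁆
Stable-⁅,⁆ {G = G} {p} {q} pq u v hu hv with ⁅,⁆⁻ {p = p} {q} {u} hu | ⁅,⁆⁻ {p = p} {q} {v} hv
... | inj₁ refl | inj₁ refl = irrefl G p
... | inj₁ refl | inj₂ refl = pq
... | inj₂ refl | inj₁ refl = trans (sym G q p) pq
... | inj₂ refl | inj₂ refl = irrefl G q

module PendantMatching {n} (G : Graph n) (m : Fin n → Fin n)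
  (m-adj : ∀ v → adj G v (m v) ≡ true) (m-involutive : ∀ v → m (m v) ≡ v)
  (m-pendant : ∀ v → PendantEdge G v (m v)) where

  open Pairing m m-involutive

  m-injective : ∀ {u v} → m u ≡ m v → u ≡ v
  m-injective {u} {v} e = trans (≡.sym (m-involutive u)) (trans (cong m e) (m-involutive v))

  Leaf : Fin n → Set
  Leaf v = ∀ x → adj G v x ≡ true → x ≡ m v

  leaf? : ∀ v → Dec (Leaf v)
  leaf? v = all? (λ x → (adj G v x ≟ᵇ true) →-dec (x ≟ m v))

  leaf-or-mate-leaf : ∀ v → Leaf v ⊎ Leaf (m v)
  leaf-or-mate-leaf v with m-pendant v
  ... | inj₁ (_ , only) = inj₁ only
  ... | inj₂ (_ , only) = inj₂ (λ x e → trans (only x e) (≡.sym (m-involutive v)))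

  ¬Leaf : ∀ {v p q} → adj G v p ≡ true → adj G v q ≡ true → p ≢ q → ¬ Leaf v
  ¬Leaf {p = p} {q} vp vq p≢q leaf = p≢q (trans (leaf p vp) (≡.sym (leaf q vq)))

  mates-nonadjacent : ∀ {a c} → ¬ Leaf a → ¬ Leaf c → adj G (m a) (m c) ≡ false
  mates-nonadjacent {a} {c} ¬leaf-a ¬leaf-c with adj G (m a) (m c) in e
  ... | false = refl
  ... | true with leaf-or-mate-leaf a | leaf-or-mate-leaf c
  ...   | inj₁ leaf-a | _ = ⊥-elim (¬leaf-a leaf-a)
  ...   | _ | inj₁ leaf-c = ⊥-elim (¬leaf-c leaf-c)
  ...   | inj₂ leaf-ma | inj₂ leaf-mc = ⊥-elim (¬leaf-a (subst Leaf mc≡a leaf-mc))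
    where
    mc≡a : m c ≡ a
    mc≡a = trans (leaf-ma (m c) e) (m-involutive a)

  leafChoice : Fin n → Bool
  leafChoice = pick (does ∘ leaf?)

  leafChoice-leaf : ∀ {v} → leafChoice v ≡ true → Leaf v
  leafChoice-leaf {v} e = dec-true⁻¹ (leaf? v) (pick-⊆ {does ∘ leaf?} e)

  leafChoice-transversal : Transversal leafChoice
  leafChoice-transversal = pick-transversal (λ v → adj⇒≢ G (m-adj v)) leaf-or-mate-leafᵇ
    where
    leaf-or-mate-leafᵇ : ∀ v → does (leaf? v) ≡ true ⊎ does (leaf? (m v)) ≡ true
    leaf-or-mate-leafᵇ v = Sum.map (dec-true (leaf? v)) (dec-true (leaf? (m v))) (leaf-or-mate-leaf v)

  StableTransversal : (Fin n → Bool) → Set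
  StableTransversal t = Transversal t × Stable G t

  transversal-leaf-nbr : ∀ {t x y} → Transversal t → Leaf x → t x ≡ true → adj G x y ≡ true → t y ≡ false
  transversal-leaf-nbr {t} {y = y} tr leaf-x tx xy =
    subst (λ z → t z ≡ false) (≡.sym (leaf-x y xy)) (transversal-mate tr tx)

  transversal-stable : ∀ {t H} → Transversal t → Stable G H → (∀ v → t v ≡ true → Leaf v ⊎ H v ≡ true) →
                       Stable G t
  transversal-stable tr H-stable cover u v tu tv with adj G u v in uv
  ... | false = refl
  ... | true with cover u tu | cover v tv
  ...   | inj₁ leaf-u | _   = ⊥-elim (≡true⇒≢false tv (transversal-leaf-nbr tr leaf-u tu uv))
  ...   | _ | inj₁ leaf-v   = ⊥-elim (≡true⇒≢false tu (transversal-leaf-nbr tr leaf-v tv (adj-sym G uv)))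
  ...   | inj₂ hu | inj₂ hv = trans (≡.sym uv) (H-stable u v hu hv)

  leafChoice-stableTransversal : StableTransversal leafChoice
  leafChoice-stableTransversal =
    leafChoice-transversal ,
    transversal-stable {H = λ _ → false} leafChoice-transversal (λ _ _ ()) (λ _ → inj₁ ∘ leafChoice-leaf)

  swapPair : Fin n → Fin n → Fin n → Bool
  swapPair s₁ s₂ = exchange leafChoice ⁅ m s₁ , m s₂ ⁆

  module _ {s₁ s₂} (d₁ : leafChoice s₁ ≡ true) (d₂ : leafChoice s₂ ≡ true) where

    open Exchange leafChoice ⁅ m s₁ , m s₂ ⁆

    swapPair-transversal : Transversal (swapPair s₁ s₂)
    swapPair-transversal = exchange-transversal leafChoice-transversal mates⊥leafChoice
      where
      mates⊥leafChoice : ∀ v → ⁅ m s₁ , m s₂ ⁆ v ≡ true → leafChoice v ≡ false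
      mates⊥leafChoice v e with ⁅,⁆⁻ {p = m s₁} {m s₂} {v} e
      ... | inj₁ refl = transversal-mate leafChoice-transversal d₁
      ... | inj₂ refl = transversal-mate leafChoice-transversal d₂

    swapPair-stableTransversal : adj G (m s₁) (m s₂) ≡ false → StableTransversal (swapPair s₁ s₂)
    swapPair-stableTransversal nonadj =
      swapPair-transversal ,
      transversal-stable swapPair-transversal (Stable-⁅,⁆ {G = G} nonadj) 
        (λ _ → Sum.swap ∘ Sum.map₂ leafChoice-leaf ∘ exchange-⊆)

    swapPair-left : swapPair s₁ s₂ s₁ ≡ false
    swapPair-left = exchange-mate swapPair-transversal (⁅,⁆-left (m s₁) (m s₂))

    swapPair-right : swapPair s₁ s₂ s₂ ≡ false
    swapPair-right = exchange-mate swapPair-transversal (⁅,⁆-right (m s₁) (m s₂))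

  swapPair-outside : ∀ {s₁ s₂ u} → leafChoice u ≡ false → u ≢ m s₁ → u ≢ m s₂ → swapPair s₁ s₂ u ≡ false
  swapPair-outside {s₁} {s₂} du u≢ms₁ u≢ms₂ =
    Exchange.exchange-outside leafChoice ⁅ m s₁ , m s₂ ⁆ du (⁅,⁆-outside u≢ms₁ u≢ms₂)

  Avoiding : Fin n → Fin n → Fin n → Fin n → Set
  Avoiding x y z w = ∃ λ t → StableTransversal t × Avoids t x y × Avoids t z w

  avoiding-oneChosenEdge : ∀ {x y z w} → x ≢ y → leafChoice x ≡ true → leafChoice y ≡ true →
                   Avoids leafChoice z w → Avoiding x y z w
  avoiding-oneChosenEdge {x} {y} {z} {w} x≢y dx dy (u , u∈zw , du) =
    Sum.[ swapAt dx (inj₁ refl) , swapAt dy (inj₂ refl) ] u≢mx⊎u≢my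
    where
    u≢mx⊎u≢my : u ≢ m x ⊎ u ≢ m y
    u≢mx⊎u≢my with u ≟ m x
    ... | no  u≢mx = inj₁ u≢mx
    ... | yes u≡mx = inj₂ (λ u≡my → x≢y (m-injective (trans (≡.sym u≡mx) u≡my)))
    swapAt : ∀ {s} → leafChoice s ≡ true → s ≡ x ⊎ s ≡ y → u ≢ m s → Avoiding x y z w
    swapAt {s} ds s∈xy u≢ms =
      swapPair s s , swapPair-stableTransversal ds ds (irrefl G (m s)) ,
      (s , s∈xy , swapPair-left ds ds) , (u , u∈zw , swapPair-outside du u≢ms u≢ms)

  swapPair-avoiding : ∀ {x y z w s₁ s₂} → leafChoice s₁ ≡ true → leafChoice s₂ ≡ true →
                      s₁ ≡ x ⊎ s₁ ≡ y → s₂ ≡ z ⊎ s₂ ≡ w → adj G (m s₁) (m s₂) ≡ false → Avoiding x y z w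
  swapPair-avoiding {s₁ = s₁} {s₂} d₁ d₂ s₁∈xy s₂∈zw nonadj =
    swapPair s₁ s₂ , swapPair-stableTransversal d₁ d₂ nonadj ,
    (s₁ , s₁∈xy , swapPair-left d₁ d₂) , (s₂ , s₂∈zw , swapPair-right d₁ d₂)

  avoiding-twoChosenEdges : ¬ HasC4 G → ∀ {x y z w} → x ≢ y → z ≢ w →
                    leafChoice x ≡ true → leafChoice y ≡ true → leafChoice z ≡ true → leafChoice w ≡ true →
                    Avoiding x y z w
  avoiding-twoChosenEdges noC4 {x} {y} {z} {w} x≢y z≢w dx dy dz dw
    with adj G (m x) (m z) in xz | adj G (m x) (m w) in xw | adj G (m y) (m z) in yz | adj G (m y) (m w) in yw
  ... | false | _     | _     | _     = swapPair-avoiding dx dz (inj₁ refl) (inj₁ refl) xz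
  ... | true  | false | _     | _     = swapPair-avoiding dx dw (inj₁ refl) (inj₂ refl) xw
  ... | true  | true  | false | _     = swapPair-avoiding dy dz (inj₂ refl) (inj₁ refl) yz
  ... | true  | true  | true  | false = swapPair-avoiding dy dw (inj₂ refl) (inj₂ refl) yw
  ... | true  | true  | true  | true  = ⊥-elim (noC4
    ( m x , m z , m y , m w
    , adj⇒≢ G xz , x≢y ∘ m-injective , adj⇒≢ G xw
    , adj⇒≢ G (adj-sym G yz) , z≢w ∘ m-injective , adj⇒≢ G yw
    , xz , adj-sym G yz , yw , adj-sym G xw ))

  avoiding-stableTransversal : ¬ HasC4 G → ∀ {x y z w} → x ≢ y → z ≢ w → Avoiding x y z w
  avoiding-stableTransversal noC4 {x} {y} {z} {w} x≢y z≢w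
    with Avoids-or-both leafChoice x y | Avoids-or-both leafChoice z w
  ... | inj₁ avoids-xy | inj₁ avoids-zw = leafChoice , leafChoice-stableTransversal , avoids-xy , avoids-zw
  ... | inj₂ (dx , dy) | inj₁ avoids-zw = avoiding-oneChosenEdge x≢y dx dy avoids-zw
  ... | inj₁ avoids-xy | inj₂ (dz , dw) = map₂ (map₂ swap) (avoiding-oneChosenEdge z≢w dz dw avoids-xy)
  ... | inj₂ (dx , dy) | inj₂ (dz , dw) = avoiding-twoChosenEdges noC4 x≢y z≢w dx dy dz dw

  noC4⇒αStable : ¬ HasC4 G → AlphaPlusPlusStable G
  noC4⇒αStable noC4 (x , y , x≢y , _) (z , w , z≢w , _) with avoiding-stableTransversal noC4 x≢y z≢w
  ... | t , (t-transversal , t-stable) , avoids-xy , avoids-zw =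
    ≤-antisym (α-antitone {G = G} {G″} G⊆G″) (begin
      α G     ≤⟨ α≤size-transversal {G} m-adj t-transversal ⟩
      size t  ≤⟨ size≤α G″ (Stable-addEdge G′ z≢w (Stable-addEdge G x≢y t-stable avoids-xy) avoids-zw) ⟩
      α G″    ∎)
    where
    open ≤-Reasoning
    G′ G″ : Graph n
    G′ = addEdge G x y x≢y
    G″ = addEdge G′ z w z≢w
    G⊆G″ : G ⊆ᴱ G″
    G⊆G″ = ⊆ᴱ-trans {G = G} {G′} {G″} (⊆ᴱ-addEdge G x≢y) (⊆ᴱ-addEdge G′ z≢w)

  C4⇒¬αStable : HasC4 G → ¬ AlphaPlusPlusStable G
  C4⇒¬αStable (a , b , c , d , _ , a≢c , _ , _ , b≢d , _ , ab , bc , cd , da) α-stable =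
    <-irrefl (α-stable e₁ e₂) (begin-strict
      α G″             <⟨ α<size-transversal {G″} matched″ G″-missesPair leafChoice-transversal ⟩
      size leafChoice  ≤⟨ size≤α G (proj₂ leafChoice-stableTransversal) ⟩
      α G              ∎)
    where
    open ≤-Reasoning
    ma≢mc : m a ≢ m c
    ma≢mc = a≢c ∘ m-injective
    mb≢md : m b ≢ m d
    mb≢md = b≢d ∘ m-injective
    e₁ e₂ : NonEdge G
    e₁ = m a , m c , ma≢mc , mates-nonadjacent (¬Leaf ab (adj-sym G da) b≢d) (¬Leaf (adj-sym G bc) cd b≢d)
    e₂ = m b , m d , mb≢md , mates-nonadjacent (¬Leaf (adj-sym G ab) bc a≢c) (¬Leaf da (adj-sym G cd) a≢c)
    G′ G″ : Graph n
    G′ = addEdge G (m a) (m c) ma≢mc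
    G″ = addEdge G′ (m b) (m d) mb≢md
    G⊆G″ : G ⊆ᴱ G″
    G⊆G″ = ⊆ᴱ-trans {G = G} {G′} {G″} (⊆ᴱ-addEdge G ma≢mc) (⊆ᴱ-addEdge G′ mb≢md)
    matched″ : Matched G″
    matched″ = G⊆G″ ∘ m-adj
    G″-missesPair : ∀ s → Stable G″ s → MissesPair s
    G″-missesPair s st = square⇒MissesPair {G″} st (G⊆G″ ab) (G⊆G″ bc) (G⊆G″ cd) (G⊆G″ da)
      (⊆ᴱ-addEdge G′ mb≢md (addEdge-adj G ma≢mc)) (addEdge-adj G′ mb≢md)

theorem4 : (n : ℕ) → n ≥ 2 → (G : Graph n) → HasPendantPerfectMatching G →
           (AlphaPlusPlusStable G → ¬ HasC4 G) × (¬ HasC4 G → AlphaPlusPlusStable G)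
theorem4 n _ G (m , m-adj , m-involutive , m-pendant) =
  (λ α-stable c4 → C4⇒¬αStable c4 α-stable) , noC4⇒αStable
  where open PendantMatching G m m-adj m-involutive m-pendant
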